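{- Let $P$ be a polygon with an interior lattice point, and let $X\subseteq\mathbb P^n$ be the associated projective toric surface, embedded via the characters corresponding to the lattice points of $P$. Then $X$ is not ruled by lines, i.e. it is not the case that every point of $X$ lies on a line of $\mathbb P^n$ contained in $X$.
   Context: - A polygon means a convex polygon in $\mathbb R^2$ with vertices in $\mathbb Z^2$. - The embedding $X\subseteq\mathbb P^n$ is the closure of the image of $(\mathbb C^*)^2\to\mathbb P^n$, $p\mapsto[\chi_0(p):\dots:\chi_n(p)]$, where $\chi_i$ are the characters $x^ay^b$ for the lattice points $(a,b)$ of $P$. -}

module Defs where

open import Level using (Level; _⊔_) renaming (suc to lsuc)
open import Data.Nat using (ℕ; zero; suc)
open import Data.Integer using (ℤ; +_; -[1+_])
open import Data.Rational as Q using (ℚ; 0ℚ; 1ℚ; ∣_∣)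
open import Data.Fin using (Fin; zero; suc)
open import Data.List using (List; []; _∷_; length)
open import Data.Product using (_×_; _,_; proj₁; proj₂; Σ; ∃; ∃-syntax)
open import Function.Definitions using (Injective)
open import Relation.Binary.PropositionalEquality using (_≡_)
open import Relation.Nullary using (¬_)
open import Algebra.Bundles using (CommutativeRing)

-- Polygons (lattice polygons given by finitely many lattice points;
-- P is their convex hull in ℝ², tested on rational points).

ℤ² : Set
ℤ² = ℤ × ℤ

ℚ² : Set
ℚ² = ℚ × ℚ

toℚ : ℤ → ℚ
toℚ z = z Q./ 1

sumℚ : ∀ {k} → (Fin k → ℚ) → ℚ
sumℚ {zero}  f = 0ℚ
sumℚ {suc k} f = f zero Q.+ sumℚ (λ i → f (suc i))

-- A lattice polygon: the convex hull of k lattice points (its vertex set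
-- is contained in this generating set).
record Polygon : Set where
  field
    k     : ℕ
    verts : Fin k → ℤ²

_∈P_ : ℚ² → Polygon → Set
q ∈P P = ∃[ w ] ((∀ i → 0ℚ Q.≤ w i)
                 × sumℚ w ≡ 1ℚ
                 × sumℚ (λ i → w i Q.* toℚ (proj₁ (verts i))) ≡ proj₁ q
                 × sumℚ (λ i → w i Q.* toℚ (proj₂ (verts i))) ≡ proj₂ q)
  where open Polygon P

embℤ² : ℤ² → ℚ²
embℤ² (a , b) = toℚ a , toℚ b

_∈ℤP_ : ℤ² → Polygon → Set
m ∈ℤP P = embℤ² m ∈P P

-- interior point of P (in ℝ²): some open box around it lies in P.
-- (P is a closed rational polytope, so testing rational points suffices.)
_∈intP_ : ℤ² → Polygon → Set
m ∈intP P = ∃[ ε ] (0ℚ Q.< ε × (∀ (q : ℚ²) →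
                ∣ proj₁ q Q.- proj₁ (embℤ² m) ∣ Q.< ε →
                ∣ proj₂ q Q.- proj₂ (embℤ² m) ∣ Q.< ε → q ∈P P))

record LatticeEnum (P : Polygon) (n : ℕ) : Set where
  field
    pt       : Fin (suc n) → ℤ²
    pt-inj   : Injective _≡_ _≡_ pt
    pt-in    : ∀ i → pt i ∈ℤP P
    pt-onto  : ∀ m → m ∈ℤP P → ∃[ i ] pt i ≡ m

-- Algebraically closed fields of characteristic 0 (the paper works over ℂ).

module _ {c ℓ} (R : CommutativeRing c ℓ) where
  open CommutativeRing R

  pow : Carrier → ℕ → Carrier
  pow x zero    = 1#
  pow x (suc m) = x * pow x m

  ntimes : ℕ → Carrier
  ntimes zero    = 0#
  ntimes (suc m) = 1# + ntimes m

  evalU : List Carrier → Carrier → Carrier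
  evalU []       x = 0#
  evalU (a ∷ cs) x = a + x * evalU cs x

record ACF0 c ℓ : Set (lsuc (c ⊔ ℓ)) where
  field
    cring : CommutativeRing c ℓ
  open CommutativeRing cring
  field
    inverse   : ∀ x → ¬ (x ≈ 0#) → ∃[ y ] (x * y ≈ 1#)
    char0     : ∀ m → ¬ (ntimes cring (suc m) ≈ 0#)
    algClosed : ∀ (cs : List Carrier) → ∃[ r ] (pow cring r (suc (length cs)) + evalU cring cs r ≈ 0#)
  open CommutativeRing cring public

data Poly {c} (A : Set c) (m : ℕ) : Set c where
  con  : A → Poly A m
  var  : Fin m → Poly A m
  _⊕_  : Poly A m → Poly A m → Poly A m
  _⊗_  : Poly A m → Poly A m → Poly A m

module Geometry {c ℓ} (K : ACF0 c ℓ) where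
  open ACF0 K

  Vecᴷ : ℕ → Set c
  Vecᴷ m = Fin m → Carrier

  eval : ∀ {m} → Poly Carrier m → Vecᴷ m → Carrier
  eval (con a)  x = a
  eval (var i)  x = x i
  eval (f ⊕ g)  x = eval f x + eval g x
  eval (f ⊗ g)  x = eval f x * eval g x

  closure : ∀ {m} → (Vecᴷ m → Set (c ⊔ ℓ)) → Vecᴷ m → Set (c ⊔ ℓ)
  closure S x = ∀ (f : Poly Carrier _) → (∀ y → S y → eval f y ≈ 0#) → eval f x ≈ 0#

  -- Laurent monomial t^a for a torus coordinate t with chosen inverse t'
  zpow : Carrier → Carrier → ℤ → Carrier
  zpow t t' (+ a)    = pow cring t a
  zpow t t' -[1+ a ] = pow cring t' (suc a)

  -- points λ·(χ₀(p),…,χₙ(p)) for p ∈ (K*)², λ ∈ K: the affine cone over the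
  -- image of the torus
  torusCone : ∀ {P n} → LatticeEnum P n → Vecᴷ (suc n) → Set (c ⊔ ℓ)
  torusCone E v = ∃[ lam ] ∃[ x ] ∃[ x' ] ∃[ y ] ∃[ y' ]
      (x * x' ≈ 1# × y * y' ≈ 1# ×
       (∀ i → v i ≈ lam * (zpow x x' (proj₁ (LatticeEnum.pt E i)) * zpow y y' (proj₂ (LatticeEnum.pt E i)))))

  -- affine cone Ĉ(X) ⊆ K^{n+1} over the projective toric surface X ⊆ ℙⁿ
  coneX : ∀ {P n} → LatticeEnum P n → Vecᴷ (suc n) → Set (c ⊔ ℓ)
  coneX E = closure (torusCone E)

  nonzero : ∀ {m} → Vecᴷ m → Set ℓ
  nonzero v = ¬ (∀ i → v i ≈ 0#)

  lin : ∀ {m} → Carrier → Vecᴷ m → Carrier → Vecᴷ m → Vecᴷ m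
  lin a u b v i = a * u i + b * v i

  linIndep : ∀ {m} → Vecᴷ m → Vecᴷ m → Set (c ⊔ ℓ)
  linIndep u v = ∀ a b → (∀ i → lin a u b v i ≈ 0#) → (a ≈ 0# × b ≈ 0#)

  -- X is ruled by lines: every point [x] of X lies on a line of ℙⁿ,
  -- i.e. ℙ(span(u,v)) with u,v independent, contained in X.
  RuledByLines : ∀ {P n} → LatticeEnum P n → Set (c ⊔ ℓ)
  RuledByLines E = ∀ x → coneX E x → nonzero x →
      ∃[ u ] ∃[ v ] (linIndep u v
        × (∀ a b → coneX E (lin a u b v))
        × ∃[ a ] ∃[ b ] (∀ i → x i ≈ lin a u b v i))

module Submission where

-- For a lattice point p of P the
-- point m - δ(p - m) still lies in P for small δ > 0, so m is a rational
-- barycentre of p and the generators of P with positive weight on p.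
-- Clearing denominators yields a list L of lattice points of P containing p
-- and balanced around m: L has the coordinate sums of |L| copies of m.
--
-- A balanced list gives the binomial relation z^L = z_m^|L|, valid
-- on the torus and hence on its Zariski closure X.  So on X the vanishing of
-- any coordinate z_p forces z_m to be nilpotent, hence zero (up to double
-- negation: equality in the field need not be decidable).
--
-- The all-ones point lies on X.  If a line span(u, v) ⊆ X contains
-- it, then for every point w of the line, w - w_p·(1,…,1) is on the line and
-- vanishes at p, hence at m; so every point of the line is a constant vector,
-- which is impossible for independent u, v.

open import Defs
open import Level using (_⊔_)
open import Data.Nat as ℕ using (ℕ; zero; suc)
import Data.Nat.Properties as ℕP
open import Data.Integer as ℤ using (ℤ; +_; -[1+_]; _⊖_)
import Data.Integer.Properties as ℤP
open import Data.Rational as Q using (ℚ; 0ℚ; 1ℚ; ∣_∣; mkℚ)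
import Data.Rational.Properties as QP
import Data.Rational.Unnormalised as U
import Data.Rational.Unnormalised.Properties as UP
open import Data.Rational.Solver using (module +-*-Solver)
open import Data.Fin using (Fin; zero; suc)
open import Data.List using (List; []; _∷_; length; map; replicate; _++_)
import Data.List.Properties as ListP
open import Data.List.Relation.Unary.All using (All; []; _∷_)
import Data.List.Relation.Unary.All.Properties as AllP
open import Data.List.Relation.Unary.Any as Any using (Any; here; there)
import Data.List.Relation.Unary.Any.Properties as AnyP
open import Data.Product using (_×_; _,_; proj₁; proj₂; Σ; ∃-syntax)
open import Data.Empty using (⊥; ⊥-elim)
open import Relation.Nullary using (¬_)
open import Relation.Nullary.Negation using (DoubleNegation; ¬¬-Monad)
open import Effect.Applicative using (RawApplicative)
open import Effect.Monad using (RawMonad)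
open import Data.Fin.Properties using (sequence)
open import Algebra.Bundles using (AbelianGroup)
open import Relation.Binary.PropositionalEquality as ≡ using (_≡_)

-- toℚ : ℤ → ℚ is an injective ring homomorphism; we compute through the
-- unnormalised rationals, where toℚ z is the fraction z/1.
toℚᵘ-toℚ : ∀ z → Q.toℚᵘ (toℚ z) U.≃ U.mkℚᵘ z 0
toℚᵘ-toℚ z = QP.toℚᵘ-fromℚᵘ (U.mkℚᵘ z 0)

toℚ-+ : ∀ a b → toℚ (a ℤ.+ b) ≡ toℚ a Q.+ toℚ b
toℚ-+ a b = QP.toℚᵘ-injective (UP.≃-trans (toℚᵘ-toℚ (a ℤ.+ b)) (UP.≃-trans fraction-sum
  (UP.≃-sym (UP.≃-trans (QP.toℚᵘ-homo-+ (toℚ a) (toℚ b)) (UP.+-cong (toℚᵘ-toℚ a) (toℚᵘ-toℚ b))))))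
  where
  fraction-sum : U.mkℚᵘ (a ℤ.+ b) 0 U.≃ U.mkℚᵘ a 0 U.+ U.mkℚᵘ b 0
  fraction-sum = U.*≡* (≡.cong (ℤ._* + 1) (≡.sym (≡.cong₂ ℤ._+_ (ℤP.*-identityʳ a) (ℤP.*-identityʳ b))))

toℚ-* : ∀ a b → toℚ (a ℤ.* b) ≡ toℚ a Q.* toℚ b
toℚ-* a b = QP.toℚᵘ-injective (UP.≃-trans (toℚᵘ-toℚ (a ℤ.* b))
  (UP.≃-sym (UP.≃-trans (QP.toℚᵘ-homo-* (toℚ a) (toℚ b)) (UP.*-cong (toℚᵘ-toℚ a) (toℚᵘ-toℚ b)))))

toℚ-ℕ* : ∀ a b → toℚ (+ (a ℕ.* b)) ≡ toℚ (+ a) Q.* toℚ (+ b)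
toℚ-ℕ* a b = ≡.trans (≡.cong toℚ (ℤP.pos-* a b)) (toℚ-* (+ a) (+ b))

toℚ-injective : ∀ {a b} → toℚ a ≡ toℚ b → a ≡ b
toℚ-injective {a} {b} e with UP.≃-trans (UP.≃-sym (toℚᵘ-toℚ a)) (UP.≃-trans (QP.toℚᵘ-cong e) (toℚᵘ-toℚ b))
... | U.*≡* h = ≡.trans (≡.sym (ℤP.*-identityʳ a)) (≡.trans h (ℤP.*-identityʳ b))

toℚ-positive : ∀ n → 0ℚ Q.< toℚ (+ suc n)
toℚ-positive n = QP.toℚᵘ-cancel-< (UP.<-respʳ-≃ (UP.≃-sym (toℚᵘ-toℚ (+ suc n))) (U.*<* (ℤ.+<+ (ℕ.s≤s ℕ.z≤n))))

nonNeg-fraction : ∀ r → 0ℚ Q.≤ r → ∃[ a ] ∃[ d ] (toℚ (+ a) ≡ toℚ (+ suc d) Q.* r)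
nonNeg-fraction (mkℚ -[1+ _ ] _ _) (Q.*≤* ())
nonNeg-fraction r@(mkℚ (+ a) d _) _ = a , d , QP.toℚᵘ-injective (UP.≃-trans (toℚᵘ-toℚ (+ a))
  (UP.≃-sym (UP.≃-trans (QP.toℚᵘ-homo-* (toℚ (+ suc d)) r) (UP.≃-trans (UP.*-cong (toℚᵘ-toℚ (+ suc d)) UP.≃-refl) cancel))))
  where
  cancel : U.mkℚᵘ (+ suc d) 0 U.* U.mkℚᵘ (+ a) d U.≃ U.mkℚᵘ (+ a) 0
  cancel = U.*≡* (≡.trans (ℤP.*-identityʳ _) (≡.trans (ℤP.*-comm (+ suc d) (+ a))
             (≡.cong (λ k → + a ℤ.* + suc k) (≡.sym (ℕP.+-identityʳ d)))))

sumℤ : ∀ {k} → (Fin k → ℤ) → ℤ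
sumℤ {zero}  f = + 0
sumℤ {suc k} f = f zero ℤ.+ sumℤ (λ i → f (suc i))

toℚ-sumℤ : ∀ {k} (f : Fin k → ℤ) → toℚ (sumℤ f) ≡ sumℚ (λ i → toℚ (f i))
toℚ-sumℤ {zero}  f = ≡.refl
toℚ-sumℤ {suc k} f = ≡.trans (toℚ-+ (f zero) _) (≡.cong (toℚ (f zero) Q.+_) (toℚ-sumℤ (λ i → f (suc i))))

sumℚ-cong : ∀ {k} {f g : Fin k → ℚ} → (∀ i → f i ≡ g i) → sumℚ f ≡ sumℚ g
sumℚ-cong {zero}  h = ≡.refl
sumℚ-cong {suc k} h = ≡.cong₂ Q._+_ (h zero) (sumℚ-cong (λ i → h (suc i)))

sumℚ-*ˡ : ∀ {k} a (f : Fin k → ℚ) → a Q.* sumℚ f ≡ sumℚ (λ i → a Q.* f i)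
sumℚ-*ˡ {zero}  a f = QP.*-zeroʳ a
sumℚ-*ˡ {suc k} a f = ≡.trans (QP.*-distribˡ-+ a (f zero) _) (≡.cong (a Q.* f zero Q.+_) (sumℚ-*ˡ a (λ i → f (suc i))))

clearDenominators : ∀ {k} (g : Fin k → ℚ) → (∀ i → 0ℚ Q.≤ g i) →
  ∃[ D ] Σ (Fin k → ℕ) λ c → ∀ i → toℚ (+ c i) ≡ toℚ (+ suc D) Q.* g i
clearDenominators {zero}  g g≥0 = 0 , (λ ()) , (λ ())
clearDenominators {suc k} g g≥0
  with clearDenominators (λ i → g (suc i)) (λ i → g≥0 (suc i)) | nonNeg-fraction (g zero) (g≥0 zero)
... | D , c , hc | a , d , ha = ℕ.pred (suc D ℕ.* suc d) , c′ , hc′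
  where
  open +-*-Solver
  open ≡.≡-Reasoning
  c′ : Fin (suc k) → ℕ
  c′ zero    = a ℕ.* suc D
  c′ (suc i) = c i ℕ.* suc d
  hc′ : ∀ i → toℚ (+ c′ i) ≡ toℚ (+ (suc D ℕ.* suc d)) Q.* g i
  hc′ zero = begin
    toℚ (+ (a ℕ.* suc D))                           ≡⟨ toℚ-ℕ* a (suc D) ⟩
    toℚ (+ a) Q.* toℚ (+ suc D)                     ≡⟨ ≡.cong (Q._* toℚ (+ suc D)) ha ⟩
    (toℚ (+ suc d) Q.* g zero) Q.* toℚ (+ suc D)    ≡⟨ solve 3 (λ x y z → (x :* y) :* z := (z :* x) :* y) ≡.refl (toℚ (+ suc d)) (g zero) (toℚ (+ suc D)) ⟩
    (toℚ (+ suc D) Q.* toℚ (+ suc d)) Q.* g zero    ≡⟨ ≡.cong (Q._* g zero) (≡.sym (toℚ-ℕ* (suc D) (suc d))) ⟩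
    toℚ (+ (suc D ℕ.* suc d)) Q.* g zero            ∎
  hc′ (suc i) = begin
    toℚ (+ (c i ℕ.* suc d))                         ≡⟨ toℚ-ℕ* (c i) (suc d) ⟩
    toℚ (+ c i) Q.* toℚ (+ suc d)                   ≡⟨ ≡.cong (Q._* toℚ (+ suc d)) (hc i) ⟩
    (toℚ (+ suc D) Q.* g (suc i)) Q.* toℚ (+ suc d) ≡⟨ solve 3 (λ x y z → (x :* y) :* z := (x :* z) :* y) ≡.refl (toℚ (+ suc D)) (g (suc i)) (toℚ (+ suc d)) ⟩
    (toℚ (+ suc D) Q.* toℚ (+ suc d)) Q.* g (suc i) ≡⟨ ≡.cong (Q._* g (suc i)) (≡.sym (toℚ-ℕ* (suc D) (suc d))) ⟩
    toℚ (+ (suc D ℕ.* suc d)) Q.* g (suc i)         ∎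

integralRelation : ∀ {k} (g : Fin k → ℚ) (D : ℕ) (c : Fin k → ℕ) →
  (∀ i → toℚ (+ c i) ≡ toℚ (+ suc D) Q.* g i) →
  (f : Fin k → ℤ) (t : ℤ) → sumℚ (λ i → g i Q.* toℚ (f i)) ≡ sumℚ g Q.* toℚ t →
  sumℤ (λ i → + c i ℤ.* f i) ≡ sumℤ (λ i → + c i) ℤ.* t
integralRelation g D c hc f t rel = toℚ-injective (begin
  toℚ (sumℤ (λ i → + c i ℤ.* f i))                ≡⟨ toℚ-sumℤ (λ i → + c i ℤ.* f i) ⟩
  sumℚ (λ i → toℚ (+ c i ℤ.* f i))                ≡⟨ sumℚ-cong (λ i → ≡.trans (toℚ-* (+ c i) (f i)) (scaled (toℚ (f i)) i)) ⟩
  sumℚ (λ i → Dq Q.* (g i Q.* toℚ (f i)))         ≡⟨ ≡.sym (sumℚ-*ˡ Dq (λ i → g i Q.* toℚ (f i))) ⟩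
  Dq Q.* sumℚ (λ i → g i Q.* toℚ (f i))           ≡⟨ ≡.cong (Dq Q.*_) rel ⟩
  Dq Q.* (sumℚ g Q.* toℚ t)                       ≡⟨ ≡.sym (QP.*-assoc Dq (sumℚ g) (toℚ t)) ⟩
  (Dq Q.* sumℚ g) Q.* toℚ t                       ≡⟨ ≡.cong (Q._* toℚ t) (sumℚ-*ˡ Dq g) ⟩
  sumℚ (λ i → Dq Q.* g i) Q.* toℚ t               ≡⟨ ≡.cong (Q._* toℚ t) (sumℚ-cong (λ i → ≡.sym (hc i))) ⟩
  sumℚ (λ i → toℚ (+ c i)) Q.* toℚ t              ≡⟨ ≡.cong (Q._* toℚ t) (≡.sym (toℚ-sumℤ (λ i → + c i))) ⟩
  toℚ (sumℤ (λ i → + c i)) Q.* toℚ t              ≡⟨ ≡.sym (toℚ-* (sumℤ (λ i → + c i)) t) ⟩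
  toℚ (sumℤ (λ i → + c i) ℤ.* t)                  ∎)
  where
  open ≡.≡-Reasoning
  Dq : ℚ
  Dq = toℚ (+ suc D)
  scaled : ∀ x i → toℚ (+ c i) Q.* x ≡ Dq Q.* (g i Q.* x)
  scaled x i = ≡.trans (≡.cong (Q._* x) (hc i)) (QP.*-assoc Dq (g i) x)

-- Balanced lists of lattice points

coordSum : (ℤ² → ℤ) → List ℤ² → ℤ
coordSum π []      = + 0
coordSum π (x ∷ L) = π x ℤ.+ coordSum π L

-- L is balanced around m if it has the coordinate sums of |L| copies of m;
-- such lists give binomial relations z^L = z_m^|L| on X.
Balanced : ℤ² → List ℤ² → Set
Balanced m L = coordSum proj₁ L ≡ coordSum proj₁ (replicate (length L) m)
             × coordSum proj₂ L ≡ coordSum proj₂ (replicate (length L) m)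

coordSum-++ : ∀ π L L′ → coordSum π (L ++ L′) ≡ coordSum π L ℤ.+ coordSum π L′
coordSum-++ π []      L′ = ≡.sym (ℤP.+-identityˡ _)
coordSum-++ π (x ∷ L) L′ = ≡.trans (≡.cong (λ s → π x ℤ.+ s) (coordSum-++ π L L′)) (≡.sym (ℤP.+-assoc (π x) _ _))

coordSum-replicate : ∀ π n x → coordSum π (replicate n x) ≡ + n ℤ.* π x
coordSum-replicate π zero    x = ≡.sym (ℤP.*-zeroˡ (π x))
coordSum-replicate π (suc n) x = ≡.trans (≡.cong (λ s → π x ℤ.+ s) (coordSum-replicate π n x)) (≡.sym (ℤP.suc-* (+ n) (π x)))

repeatEach : ∀ {k} → (Fin k → ℕ) → (Fin k → ℤ²) → List ℤ²
repeatEach {zero}  c x = []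
repeatEach {suc k} c x = replicate (c zero) (x zero) ++ repeatEach (λ i → c (suc i)) (λ i → x (suc i))

coordSum-repeatEach : ∀ π {k} (c : Fin k → ℕ) x → coordSum π (repeatEach c x) ≡ sumℤ (λ i → + c i ℤ.* π (x i))
coordSum-repeatEach π {zero}  c x = ≡.refl
coordSum-repeatEach π {suc k} c x = ≡.trans (coordSum-++ π (replicate (c zero) (x zero)) _)
  (≡.cong₂ ℤ._+_ (coordSum-replicate π (c zero) (x zero)) (coordSum-repeatEach π (λ i → c (suc i)) (λ i → x (suc i))))

length-repeatEach : ∀ {k} (c : Fin k → ℕ) x → + length (repeatEach c x) ≡ sumℤ (λ i → + c i)
length-repeatEach {zero}  c x = ≡.refl
length-repeatEach {suc k} c x = begin
  + length (replicate (c zero) (x zero) ++ rest)          ≡⟨ ≡.cong +_ (ListP.length-++ (replicate (c zero) (x zero))) ⟩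
  + (length (replicate (c zero) (x zero)) ℕ.+ length rest) ≡⟨ ≡.cong (λ n → + (n ℕ.+ length rest)) (ListP.length-replicate (c zero)) ⟩
  + (c zero ℕ.+ length rest)                             ≡⟨ ℤP.pos-+ (c zero) (length rest) ⟩
  + c zero ℤ.+ + length rest                             ≡⟨ ≡.cong (λ s → + c zero ℤ.+ s) (length-repeatEach (λ i → c (suc i)) (λ i → x (suc i))) ⟩
  sumℤ (λ i → + c i)                                     ∎
  where
  open ≡.≡-Reasoning
  rest : List ℤ²
  rest = repeatEach (λ i → c (suc i)) (λ i → x (suc i))

All-repeatEach : ∀ {Pr : ℤ² → Set} {k} (c : Fin k → ℕ) x → (∀ i → Pr (x i)) → All Pr (repeatEach c x)
All-repeatEach {k = zero}  c x h = []
All-repeatEach {k = suc k} c x h =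
  AllP.++⁺ (AllP.replicate⁺ (c zero) (h zero)) (All-repeatEach (λ i → c (suc i)) (λ i → x (suc i)) (λ i → h (suc i)))

∈-repeatEach : ∀ {k} (c : Fin k → ℕ) x i → 0 ℕ.< c i → Any (x i ≡_) (repeatEach c x)
∈-repeatEach c x zero c>0 with c zero
... | suc _ = here ≡.refl
∈-repeatEach c x (suc i) c>0 =
  AnyP.++⁺ʳ (replicate (c zero) (x zero)) (∈-repeatEach (λ j → c (suc j)) (λ j → x (suc j)) i c>0)

repeatEach-balanced : ∀ π {k} (c : Fin k → ℕ) x m →
  sumℤ (λ i → + c i ℤ.* π (x i)) ≡ sumℤ (λ i → + c i) ℤ.* π m →
  coordSum π (repeatEach c x) ≡ coordSum π (replicate (length (repeatEach c x)) m)
repeatEach-balanced π c x m rel = begin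
  coordSum π (repeatEach c x)                   ≡⟨ coordSum-repeatEach π c x ⟩
  sumℤ (λ i → + c i ℤ.* π (x i))                ≡⟨ rel ⟩
  sumℤ (λ i → + c i) ℤ.* π m                    ≡⟨ ≡.cong (ℤ._* π m) (≡.sym (length-repeatEach c x)) ⟩
  + length (repeatEach c x) ℤ.* π m             ≡⟨ ≡.sym (coordSum-replicate π (length (repeatEach c x)) m) ⟩
  coordSum π (replicate (length (repeatEach c x)) m) ∎
  where open ≡.≡-Reasoning

-- Convex geometry of the polygon

abs<bound : ∀ a b → ∣ a ∣ Q.< 1ℚ Q.+ (∣ a ∣ Q.+ ∣ b ∣)
abs<bound a b = QP.<-≤-trans
  (≡.subst (Q._< 1ℚ Q.+ ∣ a ∣) (QP.+-identityˡ ∣ a ∣) (QP.+-monoˡ-< ∣ a ∣ (QP.positive⁻¹ 1ℚ)))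
  (QP.+-monoʳ-≤ 1ℚ (≡.subst (Q._≤ ∣ a ∣ Q.+ ∣ b ∣) (QP.+-identityʳ ∣ a ∣) (QP.+-monoʳ-≤ ∣ a ∣ (QP.0≤∣p∣ b))))

smallMultiple : ∀ ε → 0ℚ Q.< ε → ∀ a b → ∃[ δ ] (0ℚ Q.< δ × ∣ δ Q.* a ∣ Q.< ε × ∣ δ Q.* b ∣ Q.< ε)
smallMultiple ε ε>0 a b = δ , QP.positive⁻¹ δ {{δ-pos}} , small a (abs<bound a b) , small b b<T
  where
  T : ℚ
  T = 1ℚ Q.+ (∣ a ∣ Q.+ ∣ b ∣)
  b<T : ∣ b ∣ Q.< T
  b<T = ≡.subst (λ s → ∣ b ∣ Q.< 1ℚ Q.+ s) (QP.+-comm ∣ b ∣ ∣ a ∣) (abs<bound b a)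
  instance
    T-pos : Q.Positive T
    T-pos = Q.positive (QP.≤-<-trans (QP.0≤∣p∣ a) (abs<bound a b))
    T-nonZero : Q.NonZero T
    T-nonZero = QP.pos⇒nonZero T
  δ : ℚ
  δ = ε Q.* Q.1/ T
  δ-pos : Q.Positive δ
  δ-pos = QP.pos*pos⇒pos ε {{Q.positive ε>0}} (Q.1/ T) {{QP.1/pos⇒pos T}}
  δT≡ε : δ Q.* T ≡ ε
  δT≡ε = ≡.trans (QP.*-assoc ε (Q.1/ T) T) (≡.trans (≡.cong (ε Q.*_) (QP.*-inverseˡ T)) (QP.*-identityʳ ε))
  small : ∀ y → ∣ y ∣ Q.< T → ∣ δ Q.* y ∣ Q.< ε
  small y y<T = ≡.subst₂ Q._<_
    (≡.sym (≡.trans (QP.∣p*q∣≡∣p∣*∣q∣ δ y) (≡.cong (Q._* ∣ y ∣) (QP.0≤p⇒∣p∣≡p (QP.<⇒≤ (QP.positive⁻¹ δ {{δ-pos}}))))))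
    δT≡ε (QP.*-monoʳ-<-pos δ {{δ-pos}} y<T)

BarycentreAlong : ∀ {k} → (ℤ² → ℤ) → (Fin k → ℚ) → (Fin k → ℤ²) → ℤ² → Set
BarycentreAlong π g x m = sumℚ (λ i → g i Q.* toℚ (π (x i))) ≡ sumℚ g Q.* toℚ (π m)

unitWeight : ∀ {k} → Fin k → Fin k → ℚ
unitWeight zero    zero    = 1ℚ
unitWeight zero    (suc j) = 0ℚ
unitWeight (suc i) zero    = 0ℚ
unitWeight (suc i) (suc j) = unitWeight i j

unitWeight≥0 : ∀ {k} (i j : Fin k) → 0ℚ Q.≤ unitWeight i j
unitWeight≥0 zero    zero    = QP.<⇒≤ (QP.positive⁻¹ 1ℚ)
unitWeight≥0 zero    (suc j) = QP.≤-refl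
unitWeight≥0 (suc i) zero    = QP.≤-refl
unitWeight≥0 (suc i) (suc j) = unitWeight≥0 i j

sum-zeroWeight : ∀ {k} (f : Fin k → ℚ) → sumℚ (λ j → 0ℚ Q.* f j) ≡ 0ℚ
sum-zeroWeight {zero}  f = ≡.refl
sum-zeroWeight {suc k} f = ≡.cong₂ Q._+_ (QP.*-zeroˡ (f zero)) (sum-zeroWeight (λ j → f (suc j)))

sum-unitWeight : ∀ {k} (i : Fin k) f → sumℚ (λ j → unitWeight i j Q.* f j) ≡ f i
sum-unitWeight zero    f = ≡.trans (≡.cong₂ Q._+_ (QP.*-identityˡ (f zero)) (sum-zeroWeight (λ j → f (suc j)))) (QP.+-identityʳ (f zero))
sum-unitWeight (suc i) f = ≡.trans (≡.cong₂ Q._+_ (QP.*-zeroˡ (f zero)) (sum-unitWeight i (λ j → f (suc j)))) (QP.+-identityˡ _)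

generator∈P : ∀ P i → Polygon.verts P i ∈ℤP P
generator∈P P i = unitWeight i , unitWeight≥0 i , total , sum-unitWeight i _ , sum-unitWeight i _
  where
  total : sumℚ (unitWeight i) ≡ 1ℚ
  total = ≡.trans (sumℚ-cong (λ j → ≡.sym (QP.*-identityʳ (unitWeight i j)))) (sum-unitWeight i (λ _ → 1ℚ))

interior⇒lattice : ∀ P m → m ∈intP P → m ∈ℤP P
interior⇒lattice P m (ε , ε>0 , box) = box (embℤ² m) (centre (proj₁ m)) (centre (proj₂ m))
  where
  centre : ∀ z → ∣ toℚ z Q.- toℚ z ∣ Q.< ε
  centre z = ≡.subst (λ w → ∣ w ∣ Q.< ε) (≡.sym (QP.+-inverseʳ (toℚ z))) ε>0

withPoint : ℤ² → (P : Polygon) → Fin (suc (Polygon.k P)) → ℤ²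
withPoint p P zero    = p
withPoint p P (suc i) = Polygon.verts P i

PointedBarycentre : (P : Polygon) → ℤ² → ℤ² → (Fin (suc (Polygon.k P)) → ℚ) → Set
PointedBarycentre P p m g = (∀ i → 0ℚ Q.≤ g i) × 0ℚ Q.< g zero
  × BarycentreAlong proj₁ g (withPoint p P) m × BarycentreAlong proj₂ g (withPoint p P) m

reflectAlong : ℚ → ℤ² → ℤ² → (ℤ² → ℤ) → ℚ
reflectAlong δ p m π = toℚ (π m) Q.- δ Q.* (toℚ (π p) Q.- toℚ (π m))

-- If m - δ(p - m) ∈ P with δ > 0, then writing it as a convex combination of
-- the generators exhibits m as a barycentre of p and the generators, with
-- positive weight δ on p.
reflectionBarycentre : ∀ P m p δ → 0ℚ Q.< δ →
  (reflectAlong δ p m proj₁ , reflectAlong δ p m proj₂) ∈P P →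
  Σ (Fin (suc (Polygon.k P)) → ℚ) (PointedBarycentre P p m)
reflectionBarycentre P m p δ δ>0 (w , w≥0 , Σw≡1 , w₁ , w₂) = g , g≥0 , δ>0 , along proj₁ w₁ , along proj₂ w₂
  where
  open Polygon P
  open +-*-Solver
  open ≡.≡-Reasoning
  g : Fin (suc k) → ℚ
  g zero    = δ
  g (suc i) = w i
  g≥0 : ∀ i → 0ℚ Q.≤ g i
  g≥0 zero    = QP.<⇒≤ δ>0
  g≥0 (suc i) = w≥0 i
  along : ∀ π → sumℚ (λ i → w i Q.* toℚ (π (verts i))) ≡ reflectAlong δ p m π →
          BarycentreAlong π g (withPoint p P) m
  along π wπ = begin
    δ Q.* toℚ (π p) Q.+ sumℚ (λ i → w i Q.* toℚ (π (verts i))) ≡⟨ ≡.cong (δ Q.* toℚ (π p) Q.+_) wπ ⟩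
    δ Q.* toℚ (π p) Q.+ (toℚ (π m) Q.- δ Q.* (toℚ (π p) Q.- toℚ (π m)))
      ≡⟨ solve 3 (λ δ′ p′ m′ → δ′ :* p′ :+ (m′ :- δ′ :* (p′ :- m′)) := (δ′ :+ con 1ℚ) :* m′) ≡.refl δ (toℚ (π p)) (toℚ (π m)) ⟩
    (δ Q.+ 1ℚ) Q.* toℚ (π m)                                    ≡⟨ ≡.cong (λ s → (δ Q.+ s) Q.* toℚ (π m)) (≡.sym Σw≡1) ⟩
    (δ Q.+ sumℚ w) Q.* toℚ (π m)                                ∎

reflect-distance : ∀ δ p m π → ∣ reflectAlong δ p m π Q.- toℚ (π m) ∣ ≡ ∣ δ Q.* (toℚ (π p) Q.- toℚ (π m)) ∣
reflect-distance δ p m π = ≡.trans (≡.cong ∣_∣ shift) (QP.∣-p∣≡∣p∣ (δ Q.* (toℚ (π p) Q.- toℚ (π m))))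
  where
  open +-*-Solver
  shift : reflectAlong δ p m π Q.- toℚ (π m) ≡ Q.- (δ Q.* (toℚ (π p) Q.- toℚ (π m)))
  shift = solve 2 (λ a b → (a :- b) :- a := :- b) ≡.refl (toℚ (π m)) (δ Q.* (toℚ (π p) Q.- toℚ (π m)))

-- Around an interior point m, P contains m - δ(p - m) for δ > 0 small enough.
interiorBarycentre : ∀ P m → m ∈intP P → ∀ p →
  Σ (Fin (suc (Polygon.k P)) → ℚ) (PointedBarycentre P p m)
interiorBarycentre P m (ε , ε>0 , box) p = reflectBy (smallMultiple ε ε>0 (d proj₁) (d proj₂))
  where
  d : (ℤ² → ℤ) → ℚ
  d π = toℚ (π p) Q.- toℚ (π m)
  reflectBy : ∃[ δ ] (0ℚ Q.< δ × ∣ δ Q.* d proj₁ ∣ Q.< ε × ∣ δ Q.* d proj₂ ∣ Q.< ε) →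
              Σ (Fin (suc (Polygon.k P)) → ℚ) (PointedBarycentre P p m)
  reflectBy (δ , δ>0 , small₁ , small₂) = reflectionBarycentre P m p δ δ>0
    (box (reflectAlong δ p m proj₁ , reflectAlong δ p m proj₂) (near proj₁ small₁) (near proj₂ small₂))
    where
    near : ∀ π → ∣ δ Q.* d π ∣ Q.< ε → ∣ reflectAlong δ p m π Q.- toℚ (π m) ∣ Q.< ε
    near π = ≡.subst (Q._< ε) (≡.sym (reflect-distance δ p m π))

positive-count : ∀ n → 0ℚ Q.< toℚ (+ n) → 0 ℕ.< n
positive-count zero    0<0 = ⊥-elim (QP.<-irrefl ≡.refl 0<0)
positive-count (suc n) _   = ℕ.s≤s ℕ.z≤n

BalancedListThrough : Polygon → ℤ² → ℤ² → Set
BalancedListThrough P m p = Σ (List ℤ²) λ L → All (_∈ℤP P) L × Any (p ≡_) L × Balanced m L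

balancedListThrough : ∀ P m → m ∈intP P → ∀ p → p ∈ℤP P → BalancedListThrough P m p
balancedListThrough P m m∈int p p∈P = fromWeights (interiorBarycentre P m m∈int p)
  where
  x : Fin (suc (Polygon.k P)) → ℤ²
  x = withPoint p P
  points∈P : ∀ i → x i ∈ℤP P
  points∈P zero    = p∈P
  points∈P (suc i) = generator∈P P i
  fromWeights : Σ (Fin (suc (Polygon.k P)) → ℚ) (PointedBarycentre P p m) → BalancedListThrough P m p
  fromWeights (g , g≥0 , g₀>0 , bary₁ , bary₂) = fromCounts (clearDenominators g g≥0)
    where
    fromCounts : ∃[ D ] Σ (Fin (suc (Polygon.k P)) → ℕ) (λ c → ∀ i → toℚ (+ c i) ≡ toℚ (+ suc D) Q.* g i) →
                 BalancedListThrough P m p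
    fromCounts (D , c , hc) =
      repeatEach c x , All-repeatEach c x points∈P , ∈-repeatEach c x zero c₀>0 ,
      repeatEach-balanced proj₁ c x m (integralRelation g D c hc (λ i → proj₁ (x i)) (proj₁ m) bary₁) ,
      repeatEach-balanced proj₂ c x m (integralRelation g D c hc (λ i → proj₂ (x i)) (proj₂ m) bary₂)
      where
      c₀>0 : 0 ℕ.< c zero
      c₀>0 = positive-count (c zero) (≡.subst (0ℚ Q.<_) (≡.sym (hc zero))
               (QP.positive⁻¹ _ {{QP.pos*pos⇒pos (toℚ (+ suc D)) {{Q.positive (toℚ-positive D)}} (g zero) {{Q.positive g₀>0}}}}))

-- Algebra over an algebraically closed field of characteristic 0

module FieldFacts {c ℓ} (K : ACF0 c ℓ) where
  open ACF0 K
  open Geometry K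
  open import Relation.Binary.Reasoning.Setoid setoid
  open import Algebra.Properties.CommutativeSemiring.Exp commutativeSemiring using (_^_; ^-congˡ; ^-homo-*; ^-distrib-*)
  open import Algebra.Properties.Ring ring using (-1*x≈-x)
  open import Algebra.Properties.Group (AbelianGroup.group +-abelianGroup) using (x∙y⁻¹≈ε⇒x≈y; x≈y⇒x∙y⁻¹≈ε)
  open import Algebra.Solver.CommutativeMonoid *-commutativeMonoid using (solve; _⊜_) renaming (_⊕_ to _:*_)

  1≉0 : ¬ (1# ≈ 0#)
  1≉0 1≈0 = char0 0 (trans (+-identityʳ 1#) 1≈0)

  pow≡^ : ∀ x n → pow cring x n ≡ x ^ n
  pow≡^ x zero    = ≡.refl
  pow≡^ x (suc n) = ≡.cong (x *_) (pow≡^ x n)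

  pow-+ : ∀ x i j → pow cring x (i ℕ.+ j) ≈ pow cring x i * pow cring x j
  pow-+ x i j = begin
    pow cring x (i ℕ.+ j)           ≡⟨ pow≡^ x (i ℕ.+ j) ⟩
    x ^ (i ℕ.+ j)                   ≈⟨ ^-homo-* x i j ⟩
    x ^ i * x ^ j                   ≡⟨ ≡.sym (≡.cong₂ _*_ (pow≡^ x i) (pow≡^ x j)) ⟩
    pow cring x i * pow cring x j   ∎

  pow-1 : ∀ n → pow cring 1# n ≈ 1#
  pow-1 zero    = refl
  pow-1 (suc n) = trans (*-identityˡ _) (pow-1 n)

  pow-inverse : ∀ t t′ → t * t′ ≈ 1# → ∀ n → pow cring t n * pow cring t′ n ≈ 1#
  pow-inverse t t′ tt′≈1 n = begin
    pow cring t n * pow cring t′ n  ≡⟨ ≡.cong₂ _*_ (pow≡^ t n) (pow≡^ t′ n) ⟩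
    t ^ n * t′ ^ n                  ≈⟨ sym (^-distrib-* t t′ n) ⟩
    (t * t′) ^ n                    ≈⟨ ^-congˡ n tt′≈1 ⟩
    1# ^ n                          ≡⟨ ≡.sym (pow≡^ 1# n) ⟩
    pow cring 1# n                  ≈⟨ pow-1 n ⟩
    1#                              ∎

  -- A field has no nilpotents; constructively we only get ¬¬ z ≈ 0, because
  -- the equality of K need not be decidable.
  nilpotent⇒¬¬zero : ∀ z N → pow cring z (suc N) ≈ 0# → ¬ ¬ (z ≈ 0#)
  nilpotent⇒¬¬zero z N zᴺ≈0 z≉0 with inverse z z≉0
  ... | z′ , zz′≈1 = 1≉0 (begin
    1#                                            ≈⟨ sym (pow-inverse z z′ zz′≈1 (suc N)) ⟩
    pow cring z (suc N) * pow cring z′ (suc N)    ≈⟨ *-cong zᴺ≈0 refl ⟩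
    0# * pow cring z′ (suc N)                     ≈⟨ zeroˡ _ ⟩
    0#                                            ∎)

  unit-cancel : ∀ {t t′} → t * t′ ≈ 1# → ∀ a b → (t * a) * (t′ * b) ≈ a * b
  unit-cancel {t} {t′} tt′≈1 a b = begin
    (t * a) * (t′ * b)   ≈⟨ solve 4 (λ t a t′ b → (t :* a) :* (t′ :* b) ⊜ (t :* t′) :* (a :* b)) refl t a t′ b ⟩
    (t * t′) * (a * b)   ≈⟨ *-cong tt′≈1 refl ⟩
    1# * (a * b)         ≈⟨ *-identityˡ _ ⟩
    a * b                ∎

  module Laurent (t t′ : Carrier) (tt′≈1 : t * t′ ≈ 1#) where
    φ : ℤ → Carrier
    φ = zpow t t′

    φ-⊖ : ∀ i j → φ (i ⊖ j) ≈ pow cring t i * pow cring t′ j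
    φ-⊖ i       zero    = sym (*-identityʳ _)
    φ-⊖ zero    (suc j) = sym (*-identityˡ _)
    φ-⊖ (suc i) (suc j) = begin
      φ (suc i ⊖ suc j)                            ≡⟨ ≡.cong φ (ℤP.[1+m]⊖[1+n]≡m⊖n i j) ⟩
      φ (i ⊖ j)                                    ≈⟨ φ-⊖ i j ⟩
      pow cring t i * pow cring t′ j               ≈⟨ sym (unit-cancel tt′≈1 _ _) ⟩
      pow cring t (suc i) * pow cring t′ (suc j)   ∎

    φ-⊖-+ : ∀ i j b → φ ((i ⊖ j) ℤ.+ b) ≈ φ (i ⊖ j) * φ b
    φ-⊖-+ i j (+ k) = begin
      φ ((i ⊖ j) ℤ.+ + k)                         ≡⟨ ≡.cong φ (ℤP.distribˡ-⊖-+-pos k i j) ⟩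
      φ (i ℕ.+ k ⊖ j)                             ≈⟨ φ-⊖ (i ℕ.+ k) j ⟩
      pow cring t (i ℕ.+ k) * pow cring t′ j      ≈⟨ *-cong (pow-+ t i k) refl ⟩
      (pow cring t i * pow cring t k) * pow cring t′ j
        ≈⟨ solve 3 (λ a b c → (a :* b) :* c ⊜ (a :* c) :* b) refl (pow cring t i) (pow cring t k) (pow cring t′ j) ⟩
      (pow cring t i * pow cring t′ j) * pow cring t k ≈⟨ *-cong (sym (φ-⊖ i j)) refl ⟩
      φ (i ⊖ j) * φ (+ k)                         ∎
    φ-⊖-+ i j -[1+ l ] = begin
      φ ((i ⊖ j) ℤ.+ -[1+ l ])                    ≡⟨ ≡.cong φ (ℤP.distribˡ-⊖-+-neg l i j) ⟩
      φ (i ⊖ suc (j ℕ.+ l))                       ≡⟨ ≡.cong (λ s → φ (i ⊖ s)) (≡.sym (ℕP.+-suc j l)) ⟩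
      φ (i ⊖ (j ℕ.+ suc l))                       ≈⟨ φ-⊖ i (j ℕ.+ suc l) ⟩
      pow cring t i * pow cring t′ (j ℕ.+ suc l)  ≈⟨ *-cong refl (pow-+ t′ j (suc l)) ⟩
      pow cring t i * (pow cring t′ j * pow cring t′ (suc l)) ≈⟨ sym (*-assoc _ _ _) ⟩
      (pow cring t i * pow cring t′ j) * pow cring t′ (suc l) ≈⟨ *-cong (sym (φ-⊖ i j)) refl ⟩
      φ (i ⊖ j) * φ -[1+ l ]                      ∎

    -- φ turns sums into products (every integer is i ⊖ j).
    φ-+ : ∀ a b → φ (a ℤ.+ b) ≈ φ a * φ b
    φ-+ (+ i)    = φ-⊖-+ i 0
    φ-+ -[1+ j ] = φ-⊖-+ 0 (suc j)

  -- Polynomial identities valid on a set remain valid on its Zariski closure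
  -- (apply the defining property of the closure to f - g).
  closure-identity : ∀ {m} (S : Vecᴷ m → Set (c ⊔ ℓ)) (f g : Poly Carrier m) →
    (∀ y → S y → eval f y ≈ eval g y) → ∀ y → closure S y → eval f y ≈ eval g y
  closure-identity S f g f≈g y y∈S̄ = x∙y⁻¹≈ε⇒x≈y _ _
    (trans (+-cong refl (sym (-1*x≈-x _))) (y∈S̄ (f ⊕ (con (- 1#) ⊗ g))
      (λ z z∈S → trans (+-cong refl (-1*x≈-x _)) (x≈y⇒x∙y⁻¹≈ε (f≈g z z∈S)))))

-- Lines through the all-ones vector

module LinesThroughOnes {c ℓ} (K : ACF0 c ℓ) where
  open ACF0 K
  open Geometry K
  open FieldFacts K using (1≉0)
  open import Relation.Binary.Reasoning.Setoid setoid
  open import Algebra.Properties.Ring ring using (-‿distribˡ-*)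
  open import Algebra.Properties.AbelianGroup +-abelianGroup using (⁻¹-∙-comm)
  open import Algebra.Properties.Group (AbelianGroup.group +-abelianGroup) using (x∙y⁻¹≈ε⇒x≈y)
  open import Algebra.Solver.CommutativeMonoid +-commutativeMonoid using (solve; _⊜_) renaming (_⊕_ to _:+_)

  -- In coordinates: w - s·o for points w = αu + βv and o = au + bv of span(u, v)
  -- is again the point (α - sa)u + (β - sb)v of span(u, v).
  lin-shift : ∀ α β s a b U V → (α - s * a) * U + (β - s * b) * V ≈ (α * U + β * V) - s * (a * U + b * V)
  lin-shift α β s a b U V = begin
    (α - s * a) * U + (β - s * b) * V
      ≈⟨ +-cong (distribʳ U α (- (s * a))) (distribʳ V β (- (s * b))) ⟩
    (α * U + - (s * a) * U) + (β * V + - (s * b) * V)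
      ≈⟨ +-cong (+-cong refl (sym (-‿distribˡ-* (s * a) U))) (+-cong refl (sym (-‿distribˡ-* (s * b) V))) ⟩
    (α * U + - (s * a * U)) + (β * V + - (s * b * V))
      ≈⟨ solve 4 (λ p q r t → (p :+ q) :+ (r :+ t) ⊜ (p :+ r) :+ (q :+ t))
           refl (α * U) (- (s * a * U)) (β * V) (- (s * b * V)) ⟩
    (α * U + β * V) + (- (s * a * U) + - (s * b * V))
      ≈⟨ +-cong refl (⁻¹-∙-comm _ _) ⟩
    (α * U + β * V) - (s * a * U + s * b * V)
      ≈⟨ +-cong refl (-‿cong (trans (+-cong (*-assoc s a U) (*-assoc s b V)) (sym (distribˡ s _ _)))) ⟩
    (α * U + β * V) - s * (a * U + b * V)
      ∎

  lin-left : ∀ {N} (u v : Vecᴷ N) i → lin 1# u 0# v i ≈ u i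
  lin-left u v i = trans (+-cong (*-identityˡ _) (zeroˡ _)) (+-identityʳ _)

  lin-right : ∀ {N} (u v : Vecᴷ N) i → lin 0# u 1# v i ≈ v i
  lin-right u v i = trans (+-cong (zeroˡ _) (*-identityˡ _)) (+-identityˡ _)

  -- Two constant vectors are linearly dependent: v_o·u - u_o·v = 0 forces
  -- u_o = 0, and then u = 0.
  constants-dependent : ∀ {N} (o : Fin N) {u v : Vecᴷ N} → linIndep u v →
    (∀ j → u j ≈ u o) → (∀ j → v j ≈ v o) → ⊥
  constants-dependent o {u} {v} indep u-const v-const = 1≉0 (proj₁ (indep 1# 0# u≈0))
    where
    u_o≈0 : u o ≈ 0#
    u_o≈0 = proj₂ (indep (- v o) (u o) (λ i → begin
      - v o * u i + u o * v i     ≈⟨ +-cong (*-cong refl (u-const i)) (*-cong refl (v-const i)) ⟩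
      - v o * u o + u o * v o     ≈⟨ +-cong (sym (-‿distribˡ-* (v o) (u o))) (*-comm (u o) (v o)) ⟩
      - (v o * u o) + v o * u o   ≈⟨ -‿inverseˡ _ ⟩
      0#                          ∎))
    u≈0 : ∀ i → lin 1# u 0# v i ≈ 0#
    u≈0 i = trans (lin-left u v i) (trans (u-const i) u_o≈0)

  ForcesZeroAt : ∀ {N} → (Vecᴷ N → Set (c ⊔ ℓ)) → Fin N → Set (c ⊔ ℓ)
  ForcesZeroAt C o = ∀ y → C y → ∀ j → y j ≈ 0# → ¬ ¬ (y o ≈ 0#)

  module _ {N} {C : Vecᴷ N → Set (c ⊔ ℓ)} {o : Fin N} (forces : ForcesZeroAt C o)
           {u v : Vecᴷ N} (line⊆C : ∀ α β → C (lin α u β v))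
           {a b : Carrier} (ones-on-line : ∀ i → 1# ≈ lin a u b v i) where

    -- If the line span(u, v) ⊆ C passes through (1,…,1), each of its points w
    -- is constant: w - w_j·(1,…,1) lies on the line and vanishes at j.
    constant-on-line : ∀ α β j → ¬ ¬ (lin α u β v j ≈ lin α u β v o)
    constant-on-line α β j w_j≉w_o =
      forces y (line⊆C (α - s * a) (β - s * b)) j yj≈0 (λ yo≈0 → w_j≉w_o (sym (x∙y⁻¹≈ε⇒x≈y _ _ (trans (sym (y≈w-s o)) yo≈0))))
      where
      s : Carrier
      s = lin α u β v j
      y : Vecᴷ N
      y = lin (α - s * a) u (β - s * b) v
      y≈w-s : ∀ i → y i ≈ lin α u β v i - s
      y≈w-s i = trans (lin-shift α β s a b (u i) (v i)) (+-cong refl (-‿cong (trans (*-cong refl (sym (ones-on-line i))) (*-identityʳ s))))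
      yj≈0 : y j ≈ 0#
      yj≈0 = trans (y≈w-s j) (-‿inverseʳ s)

    -- Hence such a set contains no line through (1,…,1): both u and v would
    -- be constant.
    no-line-through-ones : ¬ linIndep u v
    no-line-through-ones indep =
      sequence ¬¬-applicative (constant-on-line 1# 0#) λ u-const →
      sequence ¬¬-applicative (constant-on-line 0# 1#) λ v-const →
      constants-dependent o indep
        (λ j → trans (sym (lin-left u v j)) (trans (u-const j) (lin-left u v o)))
        (λ j → trans (sym (lin-right u v j)) (trans (v-const j) (lin-right u v o)))
      where
      ¬¬-applicative : RawApplicative (DoubleNegation {ℓ})
      ¬¬-applicative = RawMonad.rawApplicative ¬¬-Monad

-- Binomial relations on the toric surface

module Surface {c ℓ} (K : ACF0 c ℓ) {P : Polygon} {n : ℕ} (E : LatticeEnum P n) where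
  open ACF0 K
  open Geometry K
  open FieldFacts K
  open LinesThroughOnes K using (ForcesZeroAt)
  open LatticeEnum E
  open import Relation.Binary.Reasoning.Setoid setoid
  open import Algebra.Solver.CommutativeMonoid *-commutativeMonoid using (solve; _⊜_) renaming (_⊕_ to _:*_)

  Index : Set
  Index = Fin (suc n)

  monomial : Vecᴷ (suc n) → List Index → Carrier
  monomial y []      = 1#
  monomial y (i ∷ I) = y i * monomial y I

  monomialPoly : List Index → Poly Carrier (suc n)
  monomialPoly []      = con 1#
  monomialPoly (i ∷ I) = var i ⊗ monomialPoly I

  eval-monomialPoly : ∀ y I → eval (monomialPoly I) y ≡ monomial y I
  eval-monomialPoly y []      = ≡.refl
  eval-monomialPoly y (i ∷ I) = ≡.cong (y i *_) (eval-monomialPoly y I)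

  monomial-replicate : ∀ y i N → monomial y (replicate N i) ≡ pow cring (y i) N
  monomial-replicate y i zero    = ≡.refl
  monomial-replicate y i (suc N) = ≡.cong (y i *_) (monomial-replicate y i N)

  monomial-vanishes : ∀ y j I → Any (j ≡_) I → y j ≈ 0# → monomial y I ≈ 0#
  monomial-vanishes y j (i ∷ I) (here ≡.refl) yj≈0 = trans (*-cong yj≈0 refl) (zeroˡ _)
  monomial-vanishes y j (i ∷ I) (there j∈I)   yj≈0 = trans (*-cong refl (monomial-vanishes y j I j∈I yj≈0)) (zeroʳ _)

  exponent : (ℤ² → ℤ) → List Index → ℤ
  exponent π I = coordSum π (map pt I)

  monomial-on-torus : ∀ lam x x′ y y′ (xx′≈1 : x * x′ ≈ 1#) (yy′≈1 : y * y′ ≈ 1#) w →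
    (∀ i → w i ≈ lam * (zpow x x′ (proj₁ (pt i)) * zpow y y′ (proj₂ (pt i)))) → ∀ I →
    monomial w I ≈ pow cring lam (length I) * (zpow x x′ (exponent proj₁ I) * zpow y y′ (exponent proj₂ I))
  monomial-on-torus lam x x′ y y′ xx′≈1 yy′≈1 w w≈χ [] = sym (trans (*-identityˡ _) (*-identityˡ _))
  monomial-on-torus lam x x′ y y′ xx′≈1 yy′≈1 w w≈χ (i ∷ I) = begin
    w i * monomial w I
      ≈⟨ *-cong (w≈χ i) (monomial-on-torus lam x x′ y y′ xx′≈1 yy′≈1 w w≈χ I) ⟩
    (lam * (X.φ a * Y.φ b)) * (pow cring lam (length I) * (X.φ A * Y.φ B))
      ≈⟨ solve 6 (λ l p q L r s → (l :* (p :* q)) :* (L :* (r :* s)) ⊜ (l :* L) :* ((p :* r) :* (q :* s)))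
           refl lam (X.φ a) (Y.φ b) (pow cring lam (length I)) (X.φ A) (Y.φ B) ⟩
    (lam * pow cring lam (length I)) * ((X.φ a * X.φ A) * (Y.φ b * Y.φ B))
      ≈⟨ *-cong refl (*-cong (sym (X.φ-+ a A)) (sym (Y.φ-+ b B))) ⟩
    pow cring lam (suc (length I)) * (X.φ (a ℤ.+ A) * Y.φ (b ℤ.+ B))
      ∎
    where
    module X = Laurent x x′ xx′≈1
    module Y = Laurent y y′ yy′≈1
    a = proj₁ (pt i)
    b = proj₂ (pt i)
    A = exponent proj₁ I
    B = exponent proj₂ I

  -- Index lists of equal length and equal exponents give a binomial relation
  -- z^I = z^J, valid on the torus and hence on its closure X.
  binomial-on-X : ∀ I J → length I ≡ length J → exponent proj₁ I ≡ exponent proj₁ J →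
    exponent proj₂ I ≡ exponent proj₂ J → ∀ y → coneX E y → monomial y I ≈ monomial y J
  binomial-on-X I J |I|≡|J| e₁ e₂ y y∈X = begin
    monomial y I                   ≡⟨ ≡.sym (eval-monomialPoly y I) ⟩
    eval (monomialPoly I) y        ≈⟨ closure-identity (torusCone E) (monomialPoly I) (monomialPoly J) on-torus y y∈X ⟩
    eval (monomialPoly J) y        ≡⟨ eval-monomialPoly y J ⟩
    monomial y J                   ∎
    where
    on-torus : ∀ w → torusCone E w → eval (monomialPoly I) w ≈ eval (monomialPoly J) w
    on-torus w (lam , x , x′ , y , y′ , xx′≈1 , yy′≈1 , w≈χ) = begin
      eval (monomialPoly I) w   ≡⟨ eval-monomialPoly w I ⟩
      monomial w I              ≈⟨ monomial-on-torus lam x x′ y y′ xx′≈1 yy′≈1 w w≈χ I ⟩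
      pow cring lam (length I) * (zpow x x′ (exponent proj₁ I) * zpow y y′ (exponent proj₂ I))
        ≡⟨ ≡.cong₂ (λ N e → pow cring lam N * (zpow x x′ (proj₁ e) * zpow y y′ (proj₂ e))) |I|≡|J| (≡.cong₂ _,_ e₁ e₂) ⟩
      pow cring lam (length J) * (zpow x x′ (exponent proj₁ J) * zpow y y′ (exponent proj₂ J))
        ≈⟨ sym (monomial-on-torus lam x x′ y y′ xx′≈1 yy′≈1 w w≈χ J) ⟩
      monomial w J              ≡⟨ ≡.sym (eval-monomialPoly w J) ⟩
      eval (monomialPoly J) w   ∎

  -- A list of indices containing j with the exponents of |I| copies of o gives
  -- z^I = z_o^|I| on X; so on X, z_j = 0 forces z_o to be nilpotent, i.e. zero.
  balanced-forces-zero : ∀ o j I → Any (j ≡_) I →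
    exponent proj₁ I ≡ exponent proj₁ (replicate (length I) o) →
    exponent proj₂ I ≡ exponent proj₂ (replicate (length I) o) →
    ∀ y → coneX E y → y j ≈ 0# → ¬ ¬ (y o ≈ 0#)
  balanced-forces-zero o j I@(_ ∷ I′) j∈I e₁ e₂ y y∈X yj≈0 = nilpotent⇒¬¬zero (y o) (length I′) (begin
    pow cring (y o) (length I)             ≡⟨ ≡.sym (monomial-replicate y o (length I)) ⟩
    monomial y (replicate (length I) o)    ≈⟨ sym (binomial-on-X I (replicate (length I) o) (≡.sym (ListP.length-replicate (length I))) e₁ e₂ y y∈X) ⟩
    monomial y I                           ≈⟨ monomial-vanishes y j I j∈I yj≈0 ⟩
    0#                                     ∎)

  indicesOf : ∀ L → All (_∈ℤP P) L → Σ (List Index) λ I → map pt I ≡ L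
  indicesOf []      []            = [] , ≡.refl
  indicesOf (x ∷ L) (x∈P ∷ L⊆P) =
    proj₁ (pt-onto x x∈P) ∷ proj₁ (indicesOf L L⊆P) , ≡.cong₂ _∷_ (proj₂ (pt-onto x x∈P)) (proj₂ (indicesOf L L⊆P))

  interior-forces-zero : ∀ o → pt o ∈intP P → ForcesZeroAt (coneX E) o
  interior-forces-zero o o∈int y y∈X j yj≈0 = through (balancedListThrough P (pt o) o∈int (pt j) (pt-in j))
    where
    through : BalancedListThrough P (pt o) (pt j) → ¬ ¬ (y o ≈ 0#)
    through (L , L⊆P , ptj∈L , bal₁ , bal₂) =
      balanced-forces-zero o j I j∈I (along proj₁ bal₁) (along proj₂ bal₂) y y∈X yj≈0
      where
      I : List Index
      I = proj₁ (indicesOf L L⊆P)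
      I↦L : map pt I ≡ L
      I↦L = proj₂ (indicesOf L L⊆P)
      j∈I : Any (j ≡_) I
      j∈I = Any.map pt-inj (AnyP.map⁻ (≡.subst (Any (pt j ≡_)) (≡.sym I↦L) ptj∈L))
      copies : replicate (length L) (pt o) ≡ map pt (replicate (length I) o)
      copies = ≡.trans (≡.cong (λ N → replicate N (pt o)) (≡.trans (≡.cong length (≡.sym I↦L)) (ListP.length-map pt I)))
                       (≡.sym (ListP.map-replicate pt (length I) o))
      along : ∀ π → coordSum π L ≡ coordSum π (replicate (length L) (pt o)) →
              exponent π I ≡ exponent π (replicate (length I) o)
      along π bal = ≡.trans (≡.cong (coordSum π) I↦L) (≡.trans bal (≡.cong (coordSum π) copies))

  -- The all-ones vector is the image of the identity of the torus.
  ones∈X : coneX E (λ _ → 1#)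
  ones∈X f f-vanishes = f-vanishes (λ _ → 1#) (1# , 1# , 1# , 1# , 1# , *-identityʳ 1# , *-identityʳ 1# , ones-on-torus)
    where
    zpow-1 : ∀ z → zpow 1# 1# z ≈ 1#
    zpow-1 (+ k)    = pow-1 k
    zpow-1 -[1+ k ] = pow-1 (suc k)
    ones-on-torus : ∀ i → 1# ≈ 1# * (zpow 1# 1# (proj₁ (pt i)) * zpow 1# 1# (proj₂ (pt i)))
    ones-on-torus i = sym (trans (*-identityˡ _) (trans (*-cong (zpow-1 (proj₁ (pt i))) (zpow-1 (proj₂ (pt i)))) (*-identityʳ 1#)))

-- The line through (1,…,1) provided by a ruling would consist of constant
-- vectors, since on X every coordinate's vanishing forces the vanishing of
-- the coordinate of the interior point.
corollaryA7 : ∀ {c ℓ} (K : ACF0 c ℓ) (P : Polygon) (n : ℕ) (E : LatticeEnum P n) → ∃[ m ] (m ∈intP P) → ¬ Geometry.RuledByLines K E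
corollaryA7 K P n E (m , m∈int) ruled = refute (ruled (λ _ → 1#) ones∈X (λ ones≈0 → 1≉0 (ones≈0 zero)))
  where
  open ACF0 K using (1#; _≈_)
  open Geometry K
  open FieldFacts K using (1≉0)
  open LinesThroughOnes K using (ForcesZeroAt; no-line-through-ones)
  open Surface K E
  open LatticeEnum E
  m-index : ∃[ o ] (pt o ≡ m)
  m-index = pt-onto m (interior⇒lattice P m m∈int)
  forces : ForcesZeroAt (coneX E) (proj₁ m-index)
  forces = interior-forces-zero (proj₁ m-index) (≡.subst (_∈intP P) (≡.sym (proj₂ m-index)) m∈int)
  refute : ∃[ u ] ∃[ v ] (linIndep u v × (∀ a b → coneX E (lin a u b v)) × ∃[ a ] ∃[ b ] (∀ i → 1# ≈ lin a u b v i)) → ⊥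
  refute (u , v , indep , line⊆X , a , b , ones-on-line) = no-line-through-ones forces line⊆X ones-on-line indep
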